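{- There exist $(P_3,l)$-jumbles for infinitely many positive integers $l$.
   Context: Graphs are finite and simple; $P_3$ is the path on three vertices, and a graph is $P_3$-free if it has no induced subgraph isomorphic to $P_3$. For a positive integer $l$, a graph $H$ is a $(P_3,l)$-jumble if (S1) for every $0\le s\le l-1$, $V(H)$ can be partitioned into $s$ stable sets, $l-1-s$ cliques, and a set $Z$ such that $H[Z]$ is isomorphic to $P_3$; and (S2) for every partition $X_1,\dots,X_l$ of $V(H)$ there exists $i$ such that $H[X_i]$ is not $P_3$-free. -}

module Defs where

open import Data.Nat using (ℕ; suc; _∸_; _<_)
open import Data.Fin using (Fin; zero; suc)
open import Data.Bool using (Bool; true; false)
open import Data.Product using (Σ; _×_; ∃)
open import Data.Sum using (_⊎_; inj₁; inj₂)
open import Data.Unit using (⊤; tt)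
open import Relation.Binary.PropositionalEquality using (_≡_; _≢_)
open import Relation.Nullary using (¬_)
open import Function.Definitions using (Injective)

record Graph : Set where
  field
    n      : ℕ
    adj    : Fin n → Fin n → Bool
    sym    : ∀ u v → adj u v ≡ adj v u
    irrefl : ∀ v → adj v v ≡ false

open Graph public

P3adj : Fin 3 → Fin 3 → Bool
P3adj zero (suc zero) = true
P3adj (suc zero) zero = true
P3adj (suc zero) (suc (suc zero)) = true
P3adj (suc (suc zero)) (suc zero) = true
P3adj _ _ = false

P3 : Graph
P3 = record { n = 3 ; adj = P3adj ; sym = s ; irrefl = i }
  where
  s : ∀ u v → P3adj u v ≡ P3adj v u
  s zero zero = _≡_.refl
  s zero (suc zero) = _≡_.refl
  s zero (suc (suc zero)) = _≡_.refl
  s (suc zero) zero = _≡_.refl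
  s (suc zero) (suc zero) = _≡_.refl
  s (suc zero) (suc (suc zero)) = _≡_.refl
  s (suc (suc zero)) zero = _≡_.refl
  s (suc (suc zero)) (suc zero) = _≡_.refl
  s (suc (suc zero)) (suc (suc zero)) = _≡_.refl
  i : ∀ v → P3adj v v ≡ false
  i zero = _≡_.refl
  i (suc zero) = _≡_.refl
  i (suc (suc zero)) = _≡_.refl

VSet : Graph → Set₁
VSet G = Fin (n G) → Set

record InducedEmbedding (F G : Graph) (X : VSet G) : Set where
  field
    φ      : Fin (n F) → Fin (n G)
    inj    : Injective _≡_ _≡_ φ
    into   : ∀ i → X (φ i)
    presAdj : ∀ i j → adj G (φ i) (φ j) ≡ adj F i j

ContainsInduced : (F G : Graph) → VSet G → Set
ContainsInduced F G X = InducedEmbedding F G X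

InducedIso : (F G : Graph) → VSet G → Set
InducedIso F G X =
  Σ (InducedEmbedding F G X) λ e →
    ∀ v → X v → ∃ λ i → InducedEmbedding.φ e i ≡ v

P3Free : (G : Graph) → VSet G → Set
P3Free G X = ¬ ContainsInduced P3 G X

Stable : (G : Graph) → VSet G → Set
Stable G X = ∀ u v → X u → X v → adj G u v ≡ false

Clique : (G : Graph) → VSet G → Set
Clique G X = ∀ u v → X u → X v → u ≢ v → adj G u v ≡ true

Class : {G : Graph} {A : Set} → (Fin (n G) → A) → A → VSet G
Class f a v = f v ≡ a

-- (S1) for a given s: a partition of V(H) into s stable sets, l-1-s cliques
-- and a set Z with H[Z] ≅ P₃, given as a labelling of the vertices.
S1Partition : (l s : ℕ) → Graph → Set
S1Partition l s H =
  Σ (Fin (n H) → Fin s ⊎ (Fin (l ∸ suc s) ⊎ ⊤)) λ f →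
      (∀ i → Stable H (Class {H} f (inj₁ i)))
    × (∀ j → Clique H (Class {H} f (inj₂ (inj₁ j))))
    × InducedIso P3 H (Class {H} f (inj₂ (inj₂ tt)))

record IsJumble (l : ℕ) (H : Graph) : Set where
  field
    S1 : ∀ s → s < l → S1Partition l s H
    S2 : (f : Fin (n H) → Fin l) → ∃ λ i → ¬ P3Free H (Class {H} f i)

-- The jumbles are built inductively, starting from P₃ itself (a (P₃,1)-jumble).
-- From an l-jumble H, add a vertex v with no neighbours in H, and then l+1
-- pairwise non-adjacent vertices x₀,…,x_l adjacent to everything else.
--
-- (S2): take an (l+1)-colouring of the new graph.  If it misses a colour on H,
-- then H itself has a monochromatic induced P₃.  Otherwise, among the l+2
-- vertices v, x₀,…,x_l two share a colour, which also appears on some w in H;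
-- then v–x–w or x–w–x′ is a monochromatic induced P₃.
--
-- (S1): from a partition of H with s ≥ 1 stable sets, put x₀,…,x_l into a new
-- stable set and v into an old one.  For s = 0 and s = 1 start from the
-- partition of H into cliques and a P₃ a–b–c: the new P₃ is v–x₀–c, resp.
-- x₀–b–x₁; the other xᵢ go one per clique, and {a,b} becomes a clique, resp.
-- {a,c,v} a stable set.
module Submission where

open import Defs
open import Data.Nat using (ℕ; _<_)
open import Data.Product using (Σ; _×_)

open import Data.Nat using (zero; suc; _+_; s≤s; z≤n)
open import Data.Nat.Properties using (n<1+n; ≤-refl)
open import Data.Fin using (Fin; zero; suc; _↑ˡ_; _↑ʳ_; splitAt; punchIn; punchOut)
open import Data.Fin.Properties
  using (splitAt-↑ˡ; splitAt-↑ʳ; splitAt⁻¹-↑ˡ; splitAt⁻¹-↑ʳ; ↑ˡ-injective; ↑ʳ-injective;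
         suc-injective; punchIn-punchOut; pigeonhole; any?; all?; ¬∀⟶∃¬; <⇒≢; _≟_)
open import Data.Vec.Functional using (Vector; _++_; _∷_; []; updateAt)
open import Data.Vec.Functional.Properties
  using (lookup-++ˡ; lookup-++ʳ; updateAt-updates; updateAt-minimal)
open import Data.Bool using (Bool; true; false)
open import Data.Sum using (_⊎_; inj₁; inj₂)
open import Data.Product using (_,_; proj₁; proj₂; ∃; ∃₂)
open import Data.Unit using (⊤; tt)
open import Data.Empty using (⊥-elim)
open import Function using (_∘_; const)
open import Relation.Nullary using (yes; no)
open import Relation.Unary using (U; _⊆_; _≐_)
open import Relation.Binary.PropositionalEquality as ≡
  using (_≡_; _≢_; refl; trans; cong; subst)

private
  variable
    A : Set
    F G H : Graph
    m l : ℕ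

pattern stableLabel i = inj₁ i
pattern cliqueLabel j = inj₂ (inj₁ j)
pattern pathLabel = inj₂ (inj₂ tt)

adj-true⇒≢ : (G : Graph) {u v : Fin (n G)} → adj G u v ≡ true → u ≢ v
adj-true⇒≢ G {u} uv refl with trans (≡.sym uv) (irrefl G u)
... | ()

stable-⊆ : {X Y : VSet G} → X ⊆ Y → Stable G Y → Stable G X
stable-⊆ X⊆Y stable u v xu xv = stable u v (X⊆Y xu) (X⊆Y xv)

clique-⊆ : {X Y : VSet G} → X ⊆ Y → Clique G Y → Clique G X
clique-⊆ X⊆Y clique u v xu xv = clique u v (X⊆Y xu) (X⊆Y xv)

subsingleton-clique : {X : VSet G} → (∀ {u v} → X u → X v → u ≡ v) → Clique G X
subsingleton-clique unique u v xu xv u≢v = ⊥-elim (u≢v (unique xu xv))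

embedding-⊆ : {X Y : VSet G} → X ⊆ Y → InducedEmbedding F G X → InducedEmbedding F G Y
embedding-⊆ X⊆Y e = record
  { φ = φ ; inj = inj ; into = X⊆Y ∘ into ; presAdj = presAdj }
  where open InducedEmbedding e

∘-embedding : {Y : VSet G} (ι : InducedEmbedding H G U) →
              InducedEmbedding F H (Y ∘ InducedEmbedding.φ ι) → InducedEmbedding F G Y
∘-embedding ι e = record
  { φ = ι.φ ∘ e.φ
  ; inj = e.inj ∘ ι.inj
  ; into = e.into
  ; presAdj = λ i j → trans (ι.presAdj (e.φ i) (e.φ j)) (e.presAdj i j)
  }
  where
  module ι = InducedEmbedding ι
  module e = InducedEmbedding e

iso-≐ : {X Y : VSet G} → X ≐ Y → InducedIso F G X → InducedIso F G Y
iso-≐ (X⊆Y , Y⊆X) (e , onto) = embedding-⊆ X⊆Y e , λ v yv → onto v (Y⊆X yv)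

updateAt-const : ∀ (xs : Vector A m) i {z c : A} w → updateAt xs i (const z) w ≡ c →
                 (w ≡ i × z ≡ c) ⊎ (w ≢ i × xs w ≡ c)
updateAt-const xs i w eq with w ≟ i
... | yes refl = inj₁ (refl , trans (≡.sym (updateAt-updates i xs)) eq)
... | no w≢i = inj₂ (w≢i , trans (≡.sym (updateAt-minimal w i xs w≢i)) eq)

-- Induced copies of P₃

record IsInducedPath (G : Graph) (a b c : Fin (n G)) : Set where
  field
    adj-ab : adj G a b ≡ true
    adj-bc : adj G b c ≡ true
    adj-ac : adj G a c ≡ false
    a≢c    : a ≢ c

module _ {G : Graph} {a b c : Fin (n G)} (path : IsInducedPath G a b c) where
  open IsInducedPath path

  path-embedding : {X : VSet G} → X a → X b → X c → InducedEmbedding P3 G X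
  path-embedding {X} xa xb xc =
    record { φ = a ∷ b ∷ c ∷ [] ; inj = inj ; into = into ; presAdj = presAdj }
    where
    adj-ba : adj G b a ≡ true
    adj-ba = trans (sym G b a) adj-ab
    adj-cb : adj G c b ≡ true
    adj-cb = trans (sym G c b) adj-bc
    φ : Fin 3 → Fin (n G)
    φ = a ∷ b ∷ c ∷ []
    inj : ∀ {i j} → φ i ≡ φ j → i ≡ j
    inj {zero}             {zero}             _ = refl
    inj {zero}             {suc zero}         e = ⊥-elim (adj-true⇒≢ G adj-ab e)
    inj {zero}             {suc (suc zero)}   e = ⊥-elim (a≢c e)
    inj {suc zero}         {zero}             e = ⊥-elim (adj-true⇒≢ G adj-ba e)
    inj {suc zero}         {suc zero}         _ = refl
    inj {suc zero}         {suc (suc zero)}   e = ⊥-elim (adj-true⇒≢ G adj-bc e)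
    inj {suc (suc zero)}   {zero}             e = ⊥-elim (a≢c (≡.sym e))
    inj {suc (suc zero)}   {suc zero}         e = ⊥-elim (adj-true⇒≢ G adj-cb e)
    inj {suc (suc zero)}   {suc (suc zero)}   _ = refl
    into : ∀ i → X (φ i)
    into zero             = xa
    into (suc zero)       = xb
    into (suc (suc zero)) = xc
    presAdj : ∀ i j → adj G (φ i) (φ j) ≡ P3adj i j
    presAdj zero             zero             = irrefl G a
    presAdj zero             (suc zero)       = adj-ab
    presAdj zero             (suc (suc zero)) = adj-ac
    presAdj (suc zero)       zero             = adj-ba
    presAdj (suc zero)       (suc zero)       = irrefl G b
    presAdj (suc zero)       (suc (suc zero)) = adj-bc
    presAdj (suc (suc zero)) zero             = trans (sym G c a) adj-ac
    presAdj (suc (suc zero)) (suc zero)       = adj-cb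
    presAdj (suc (suc zero)) (suc (suc zero)) = irrefl G c

  path-iso : {X : VSet G} → X a → X b → X c →
             X ⊆ (λ v → v ≡ a ⊎ v ≡ b ⊎ v ≡ c) → InducedIso P3 G X
  path-iso {X} xa xb xc X⊆abc = path-embedding xa xb xc , onto
    where
    onto : ∀ v → X v → ∃ λ i → (a ∷ b ∷ c ∷ []) i ≡ v
    onto v xv with X⊆abc xv
    ... | inj₁ refl        = zero , refl
    ... | inj₂ (inj₁ refl) = suc zero , refl
    ... | inj₂ (inj₂ refl) = suc (suc zero) , refl

P3-path : IsInducedPath P3 zero (suc zero) (suc (suc zero))
P3-path = record { adj-ab = refl ; adj-bc = refl ; adj-ac = refl ; a≢c = λ () }

P3adj-off-centre : ∀ i j → i ≢ suc zero → j ≢ suc zero → P3adj i j ≡ false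
P3adj-off-centre (suc zero)       _                i≢1 _   = ⊥-elim (i≢1 refl)
P3adj-off-centre _                (suc zero)       _   j≢1 = ⊥-elim (j≢1 refl)
P3adj-off-centre zero             zero             _   _   = refl
P3adj-off-centre zero             (suc (suc zero)) _   _   = refl
P3adj-off-centre (suc (suc zero)) zero             _   _   = refl
P3adj-off-centre (suc (suc zero)) (suc (suc zero)) _   _   = refl

P3adj-off-end : ∀ i j → i ≢ suc (suc zero) → j ≢ suc (suc zero) → i ≢ j → P3adj i j ≡ true
P3adj-off-end zero             zero             _   _   i≢j = ⊥-elim (i≢j refl)
P3adj-off-end zero             (suc zero)       _   _   _   = refl
P3adj-off-end (suc zero)       zero             _   _   _   = refl
P3adj-off-end (suc zero)       (suc zero)       _   _   i≢j = ⊥-elim (i≢j refl)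
P3adj-off-end (suc (suc zero)) _                i≢2 _   _   = ⊥-elim (i≢2 refl)
P3adj-off-end _                (suc (suc zero)) _   j≢2 _   = ⊥-elim (j≢2 refl)

module _ {G : Graph} {X : VSet G} (iso : InducedIso P3 G X) where
  open InducedEmbedding (proj₁ iso)

  P3-iso-stable-off-centre : Stable G (λ v → X v × v ≢ φ (suc zero))
  P3-iso-stable-off-centre u v (xu , u≢b) (xv , v≢b)
    with proj₂ iso u xu | proj₂ iso v xv
  ... | i , refl | j , refl =
    trans (presAdj i j) (P3adj-off-centre i j (u≢b ∘ cong φ) (v≢b ∘ cong φ))

  P3-iso-clique-off-end : Clique G (λ v → X v × v ≢ φ (suc (suc zero)))
  P3-iso-clique-off-end u v (xu , u≢c) (xv , v≢c) u≢v
    with proj₂ iso u xu | proj₂ iso v xv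
  ... | i , refl | j , refl =
    trans (presAdj i j) (P3adj-off-end i j (u≢c ∘ cong φ) (v≢c ∘ cong φ) (u≢v ∘ cong φ))

-- Sums of graphs with constant adjacency across the two sides

data SumView (m n : ℕ) : Fin (m + n) → Set where
  left  : (x : Fin m) → SumView m n (x ↑ˡ n)
  right : (y : Fin n) → SumView m n (m ↑ʳ y)

sumView : ∀ m {n} (u : Fin (m + n)) → SumView m n u
sumView m {n} u with splitAt m {n} u in eq
... | inj₁ x = subst (SumView m n) (splitAt⁻¹-↑ˡ eq) (left x)
... | inj₂ y = subst (SumView m n) (splitAt⁻¹-↑ʳ eq) (right y)

↑ˡ≢↑ʳ : ∀ {m n} (x : Fin m) (y : Fin n) → x ↑ˡ n ≢ m ↑ʳ y
↑ˡ≢↑ʳ zero    y ()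
↑ˡ≢↑ʳ (suc x) y eq = ↑ˡ≢↑ʳ x y (suc-injective eq)

module _ (G H : Graph) (b : Bool) where
  sumAdj : Fin (n G) ⊎ Fin (n H) → Fin (n G) ⊎ Fin (n H) → Bool
  sumAdj (inj₁ x) (inj₁ y) = adj G x y
  sumAdj (inj₁ _) (inj₂ _) = b
  sumAdj (inj₂ _) (inj₁ _) = b
  sumAdj (inj₂ x) (inj₂ y) = adj H x y

  sumAdj-sym : ∀ p q → sumAdj p q ≡ sumAdj q p
  sumAdj-sym (inj₁ x) (inj₁ y) = sym G x y
  sumAdj-sym (inj₁ _) (inj₂ _) = refl
  sumAdj-sym (inj₂ _) (inj₁ _) = refl
  sumAdj-sym (inj₂ x) (inj₂ y) = sym H x y

  sumAdj-irrefl : ∀ p → sumAdj p p ≡ false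
  sumAdj-irrefl (inj₁ x) = irrefl G x
  sumAdj-irrefl (inj₂ y) = irrefl H y

_⊕⟨_⟩_ : Graph → Bool → Graph → Graph
G ⊕⟨ b ⟩ H = record
  { n = n G + n H
  ; adj = λ u v → sumAdj G H b (splitAt (n G) u) (splitAt (n G) v)
  ; sym = λ u v → sumAdj-sym G H b (splitAt (n G) u) (splitAt (n G) v)
  ; irrefl = λ u → sumAdj-irrefl G H b (splitAt (n G) u)
  }

edgeless : ℕ → Graph
edgeless m = record { n = m ; adj = λ _ _ → false ; sym = λ _ _ → refl ; irrefl = λ _ → refl }

edgeless-stable : {X : VSet (edgeless m)} → Stable (edgeless m) X
edgeless-stable _ _ _ _ = refl

module SumLemmas {G H : Graph} {b : Bool} where
  ⊕-adj-ˡˡ : ∀ x y → adj (G ⊕⟨ b ⟩ H) (x ↑ˡ n H) (y ↑ˡ n H) ≡ adj G x y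
  ⊕-adj-ˡˡ x y rewrite splitAt-↑ˡ (n G) x (n H) | splitAt-↑ˡ (n G) y (n H) = refl

  ⊕-adj-ˡʳ : ∀ x y → adj (G ⊕⟨ b ⟩ H) (x ↑ˡ n H) (n G ↑ʳ y) ≡ b
  ⊕-adj-ˡʳ x y rewrite splitAt-↑ˡ (n G) x (n H) | splitAt-↑ʳ (n G) (n H) y = refl

  ⊕-adj-ʳˡ : ∀ x y → adj (G ⊕⟨ b ⟩ H) (n G ↑ʳ x) (y ↑ˡ n H) ≡ b
  ⊕-adj-ʳˡ x y rewrite splitAt-↑ʳ (n G) (n H) x | splitAt-↑ˡ (n G) y (n H) = refl

  ⊕-adj-ʳʳ : ∀ x y → adj (G ⊕⟨ b ⟩ H) (n G ↑ʳ x) (n G ↑ʳ y) ≡ adj H x y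
  ⊕-adj-ʳʳ x y rewrite splitAt-↑ʳ (n G) (n H) x | splitAt-↑ʳ (n G) (n H) y = refl

  ⊕-inclusionˡ : InducedEmbedding G (G ⊕⟨ b ⟩ H) U
  ⊕-inclusionˡ = record
    { φ = _↑ˡ n H
    ; inj = ↑ˡ-injective (n H) _ _
    ; into = λ _ → tt
    ; presAdj = ⊕-adj-ˡˡ
    }

  module _ {g : Fin (n G) → A} {h : Fin (n H) → A} {c : A} where
    private
      Cls : VSet (G ⊕⟨ b ⟩ H)
      Cls = Class {G ⊕⟨ b ⟩ H} (g ++ h) c

      classˡ : ∀ {x} → (g ++ h) (x ↑ˡ n H) ≡ c → g x ≡ c
      classˡ {x} = trans (≡.sym (lookup-++ˡ g h x))

      classʳ : ∀ {y} → (g ++ h) (n G ↑ʳ y) ≡ c → h y ≡ c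
      classʳ {y} = trans (≡.sym (lookup-++ʳ g h y))

    ⊕-stable : Stable G (Class {G} g c) → Stable H (Class {H} h c) →
               (∀ x y → g x ≡ c → h y ≡ c → b ≡ false) → Stable (G ⊕⟨ b ⟩ H) Cls
    ⊕-stable stableG stableH across u v cu cv with sumView (n G) u | sumView (n G) v
    ... | left x  | left y  = trans (⊕-adj-ˡˡ x y) (stableG x y (classˡ cu) (classˡ cv))
    ... | left x  | right y = trans (⊕-adj-ˡʳ x y) (across x y (classˡ cu) (classʳ cv))
    ... | right x | left y  = trans (⊕-adj-ʳˡ x y) (across y x (classˡ cv) (classʳ cu))
    ... | right x | right y = trans (⊕-adj-ʳʳ x y) (stableH x y (classʳ cu) (classʳ cv))

    ⊕-clique : Clique G (Class {G} g c) → Clique H (Class {H} h c) →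
               (∀ x y → g x ≡ c → h y ≡ c → b ≡ true) → Clique (G ⊕⟨ b ⟩ H) Cls
    ⊕-clique cliqueG cliqueH across u v cu cv u≢v with sumView (n G) u | sumView (n G) v
    ... | left x  | left y  =
      trans (⊕-adj-ˡˡ x y) (cliqueG x y (classˡ cu) (classˡ cv) (u≢v ∘ cong (_↑ˡ n H)))
    ... | left x  | right y = trans (⊕-adj-ˡʳ x y) (across x y (classˡ cu) (classʳ cv))
    ... | right x | left y  = trans (⊕-adj-ʳˡ x y) (across y x (classˡ cv) (classʳ cu))
    ... | right x | right y =
      trans (⊕-adj-ʳʳ x y) (cliqueH x y (classʳ cu) (classʳ cv) (u≢v ∘ cong (n G ↑ʳ_)))

open SumLemmas public

-- (S2) with the offending class exhibited; this is the form that survives the induction.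
P3Unavoidable : ℕ → Graph → Set
P3Unavoidable l H =
  (f : Fin (n H) → Fin l) → ∃ λ i → ContainsInduced P3 H (Class {H} f i)

P3-unavoidable : P3Unavoidable 1 P3
P3-unavoidable f = zero , path-embedding P3-path (only (f _)) (only (f _)) (only (f _))
  where
  only : (i : Fin 1) → i ≡ zero
  only zero = refl

unavoidable-missing-colour : P3Unavoidable l H → (f : Fin (n H) → Fin (suc l)) (i : Fin (suc l)) →
                             (∀ w → f w ≢ i) → ∃ λ j → ContainsInduced P3 H (Class {H} f j)
unavoidable-missing-colour unavoidable f i missing =
  punchIn i j , embedding-⊆ (λ {w} gw → trans (≡.sym (punchIn-punchOut _)) (cong (punchIn i) gw)) e
  where
  g = λ w → punchOut (missing w ∘ ≡.sym)
  j = proj₁ (unavoidable g)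
  e = proj₂ (unavoidable g)

-- The extension step

step : Graph → ℕ → Graph
step H l = (H ⊕⟨ false ⟩ edgeless 1) ⊕⟨ true ⟩ edgeless (suc l)

module Step (H : Graph) (l : ℕ) where
  private
    module Inner = SumLemmas {H} {edgeless 1} {false}
    module Outer = SumLemmas {H ⊕⟨ false ⟩ edgeless 1} {edgeless (suc l)} {true}

  old : Fin (n H) → Fin (n (step H l))
  old w = (w ↑ˡ 1) ↑ˡ suc l

  new-v : Fin (n (step H l))
  new-v = (n H ↑ʳ zero) ↑ˡ suc l

  new-x : Fin (suc l) → Fin (n (step H l))
  new-x y = (n H + 1) ↑ʳ y

  old-embedding : InducedEmbedding H (step H l) U
  old-embedding = ∘-embedding Outer.⊕-inclusionˡ Inner.⊕-inclusionˡ

  path-v-x-old : ∀ y w → IsInducedPath (step H l) new-v (new-x y) (old w)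
  path-v-x-old y w = record
    { adj-ab = Outer.⊕-adj-ˡʳ _ y
    ; adj-bc = Outer.⊕-adj-ʳˡ y _
    ; adj-ac = trans (Outer.⊕-adj-ˡˡ _ _) (Inner.⊕-adj-ʳˡ zero w)
    ; a≢c = λ eq → ↑ˡ≢↑ʳ w zero (≡.sym (↑ˡ-injective (suc l) _ _ eq))
    }

  path-x-old-x : ∀ {y y′} → y ≢ y′ → ∀ w → IsInducedPath (step H l) (new-x y) (old w) (new-x y′)
  path-x-old-x {y} {y′} y≢y′ w = record
    { adj-ab = Outer.⊕-adj-ʳˡ y _
    ; adj-bc = Outer.⊕-adj-ˡʳ _ y′
    ; adj-ac = Outer.⊕-adj-ʳʳ y y′
    ; a≢c = y≢y′ ∘ ↑ʳ-injective (n H + 1) y y′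
    }

  new : Fin (suc (suc l)) → Fin (n (step H l))
  new zero    = new-v
  new (suc y) = new-x y

  step-unavoidable : P3Unavoidable l H → P3Unavoidable (suc l) (step H l)
  step-unavoidable unavoidable f with all? (λ i → any? (λ w → f (old w) ≟ i))
  ... | no ¬onto =
    let i , i-unused = ¬∀⟶∃¬ _ _ (λ i → any? (λ w → f (old w) ≟ i)) ¬onto
        j , e = unavoidable-missing-colour unavoidable (f ∘ old) i (λ w fw → i-unused (w , fw))
    in  j , ∘-embedding old-embedding e
  ... | yes onto = collision (pigeonhole (n<1+n (suc l)) (f ∘ new))
    where
    collision : (∃₂ λ p q → p Data.Fin.< q × f (new p) ≡ f (new q)) →
                ∃ λ i → ContainsInduced P3 (step H l) (Class {step H l} f i)
    collision (zero , suc y , _ , same) with onto (f (new-x y))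
    ... | w , fw = f (new-x y) , path-embedding (path-v-x-old y w) same refl fw
    collision (suc y , suc y′ , y<y′ , same) with onto (f (new-x y))
    ... | w , fw = f (new-x y) , path-embedding (path-x-old-x (<⇒≢ y<y′ ∘ cong suc) w) refl fw (≡.sym same)

  module Labelling {A : Set} (g : Fin (n H) → A) (a : A) (h : Fin (suc l) → A) where
    label : Fin (n (step H l)) → A
    label = (g ++ (a ∷ [])) ++ h

    label-old : ∀ w → label (old w) ≡ g w
    label-old w = trans (lookup-++ˡ _ h (w ↑ˡ 1)) (lookup-++ˡ g (a ∷ []) w)

    label-v : label new-v ≡ a
    label-v = trans (lookup-++ˡ _ h (n H ↑ʳ zero)) (lookup-++ʳ g (a ∷ []) zero)

    label-x : ∀ y → label (new-x y) ≡ h y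
    label-x = lookup-++ʳ (g ++ (a ∷ [])) h

    data Member (c : A) : Fin (n (step H l)) → Set where
      old-member : ∀ {w} → g w ≡ c → Member c (old w)
      v-member   : a ≡ c → Member c new-v
      x-member   : ∀ {y} → h y ≡ c → Member c (new-x y)

    member : ∀ {c} u → label u ≡ c → Member c u
    member u lu with sumView (n H + 1) u
    ... | right y = x-member (trans (≡.sym (label-x y)) lu)
    ... | left u′ with sumView (n H) u′
    ...   | left w    = old-member (trans (≡.sym (label-old w)) lu)
    ...   | right zero = v-member (trans (≡.sym label-v) lu)

    module _ {c : A} where
      label-stable : Stable H (Class {H} g c) → (∀ y → h y ≢ c) ⊎ (a ≢ c × ∀ w → g w ≢ c) →
                     Stable (step H l) (Class {step H l} label c)
      label-stable stableH apart =
        ⊕-stable (⊕-stable stableH edgeless-stable (λ _ _ _ _ → refl)) edgeless-stable (across apart)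
        where
        across : (∀ y → h y ≢ c) ⊎ (a ≢ c × ∀ w → g w ≢ c) →
                 ∀ u y → (g ++ (a ∷ [])) u ≡ c → h y ≡ c → true ≡ false
        across (inj₁ h≢c) _ y _ hy = ⊥-elim (h≢c y hy)
        across (inj₂ (a≢c , g≢c)) u _ gu _ with sumView (n H) u
        ... | left w     = ⊥-elim (g≢c w (trans (≡.sym (lookup-++ˡ g _ w)) gu))
        ... | right zero = ⊥-elim (a≢c (trans (≡.sym (lookup-++ʳ g _ zero)) gu))

      label-clique : Clique H (Class {H} g c) → a ≢ c → (∀ {y y′} → h y ≡ c → h y′ ≡ c → y ≡ y′) →
                     Clique (step H l) (Class {step H l} label c)
      label-clique cliqueH a≢c h-unique =
        ⊕-clique (⊕-clique cliqueH (λ u _ cu → ⊥-elim (v-outside u cu)) (λ _ y _ cy → ⊥-elim (v-outside y cy)))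
                 (subsingleton-clique {edgeless (suc l)} h-unique) (λ _ _ _ _ → refl)
        where
        v-outside : ∀ z → (a ∷ []) z ≢ c
        v-outside zero = a≢c

      label-iso-old : InducedIso F H (Class {H} g c) → a ≢ c → (∀ y → h y ≢ c) →
                      InducedIso F (step H l) (Class {step H l} label c)
      label-iso-old (e , onto) a≢c h≢c =
        ∘-embedding old-embedding (embedding-⊆ (λ {w} gw → trans (label-old w) gw) e) , onto′
        where
        onto′ : ∀ u → label u ≡ c → ∃ λ i → old (InducedEmbedding.φ e i) ≡ u
        onto′ u lu with member u lu
        ... | old-member {w} gw = proj₁ (onto w gw) , cong old (proj₂ (onto w gw))
        ... | v-member a≡c     = ⊥-elim (a≢c a≡c)
        ... | x-member {y} hy  = ⊥-elim (h≢c y hy)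

-- Partitions of the extended graph

S1-step-stable : ∀ {s} → S1Partition l (suc s) H → S1Partition (suc l) (suc (suc s)) (step H l)
S1-step-stable {l} {H} {s} (f , stables , cliques , iso) =
  label , stables′ , cliques′ , label-iso-old (iso-≐ (cong shift , unshift-path) iso) (λ ()) (λ _ ())
  where
  open Step H l
  shift : Fin (suc s) ⊎ _ → Fin (suc (suc s)) ⊎ _
  shift (stableLabel i) = stableLabel (suc i)
  shift (inj₂ r)        = inj₂ r
  open Labelling (shift ∘ f) (stableLabel (suc zero)) (const (stableLabel zero))

  unshift-stable : ∀ {i} → Class {H} (shift ∘ f) (stableLabel (suc i)) ⊆ Class {H} f (stableLabel i)
  unshift-stable {x = w} eq with f w
  unshift-stable refl | stableLabel _ = refl

  unshift-clique : ∀ {j} → Class {H} (shift ∘ f) (cliqueLabel j) ⊆ Class {H} f (cliqueLabel j)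
  unshift-clique {x = w} eq with f w
  unshift-clique refl | cliqueLabel _ = refl

  unshift-path : Class {H} (shift ∘ f) pathLabel ⊆ Class {H} f pathLabel
  unshift-path {w} eq with f w
  unshift-path refl | pathLabel = refl

  never-zero : ∀ w → shift (f w) ≢ stableLabel zero
  never-zero w eq with f w
  never-zero w () | stableLabel _
  never-zero w () | inj₂ _

  stables′ : ∀ i → Stable (step H l) (Class {step H l} label (stableLabel i))
  stables′ zero = label-stable (λ u _ fu → ⊥-elim (never-zero u fu)) (inj₂ ((λ ()) , never-zero))
  stables′ (suc i) = label-stable (stable-⊆ {H} unshift-stable (stables i)) (inj₁ (λ _ ()))

  cliques′ : ∀ j → Clique (step H l) (Class {step H l} label (cliqueLabel j))
  cliques′ j = label-clique (clique-⊆ {H} unshift-clique (cliques j)) (λ ()) (λ ())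

S1-step-zero : S1Partition (suc l) 0 H → S1Partition (suc (suc l)) 0 (step H (suc l))
S1-step-zero {l} {H} (f , _ , cliques , iso) =
  label , (λ ()) , cliques′ ,
  path-iso (path-v-x-old zero c) label-v (label-x zero) (trans (label-old c) (updateAt-updates c _)) on-path
  where
  open Step H (suc l)
  c = InducedEmbedding.φ (proj₁ iso) (suc (suc zero))

  relabel : Fin 0 ⊎ (Fin l ⊎ ⊤) → Fin 0 ⊎ (Fin (suc l) ⊎ ⊤)
  relabel (cliqueLabel j) = cliqueLabel (suc j)
  relabel pathLabel       = cliqueLabel zero

  g : Fin (n H) → Fin 0 ⊎ (Fin (suc l) ⊎ ⊤)
  g = updateAt (relabel ∘ f) c (const pathLabel)

  x-label : Fin (suc (suc l)) → Fin 0 ⊎ (Fin (suc l) ⊎ ⊤)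
  x-label zero    = pathLabel
  x-label (suc j) = cliqueLabel j

  open Labelling g pathLabel x-label

  ab-clique : Class {H} g (cliqueLabel zero) ⊆ (λ w → f w ≡ pathLabel × w ≢ c)
  ab-clique {w} gw with updateAt-const (relabel ∘ f) c w gw
  ... | inj₁ (_ , ())
  ... | inj₂ (w≢c , rw) = unrelabel (f w) rw , w≢c
    where
    unrelabel : ∀ r → relabel r ≡ cliqueLabel zero → r ≡ pathLabel
    unrelabel pathLabel _ = refl

  old-clique : ∀ {j} → Class {H} g (cliqueLabel (suc j)) ⊆ Class {H} f (cliqueLabel j)
  old-clique {j} {w} gw with updateAt-const (relabel ∘ f) c w gw
  ... | inj₁ (_ , ())
  ... | inj₂ (_ , rw) = unrelabel (f w) rw
    where
    unrelabel : ∀ r → relabel r ≡ cliqueLabel (suc j) → r ≡ cliqueLabel j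
    unrelabel (cliqueLabel _) refl = refl

  clique-on-H : ∀ j → Clique H (Class {H} g (cliqueLabel j))
  clique-on-H zero    = clique-⊆ {H} ab-clique (P3-iso-clique-off-end iso)
  clique-on-H (suc j) = clique-⊆ {H} old-clique (cliques j)

  cliques′ : ∀ j → Clique (step H (suc l)) (Class {step H (suc l)} label (cliqueLabel j))
  cliques′ j = label-clique (clique-on-H j) (λ ()) unique
    where
    unique : ∀ {y y′} → x-label y ≡ cliqueLabel j → x-label y′ ≡ cliqueLabel j → y ≡ y′
    unique {suc _} {suc _} refl refl = refl

  on-path : ∀ {u} → label u ≡ pathLabel → u ≡ new-v ⊎ u ≡ new-x zero ⊎ u ≡ old c
  on-path {u} lu with member u lu
  ... | v-member _          = inj₁ refl
  ... | x-member {zero} _   = inj₂ (inj₁ refl)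
  ... | old-member {w} gw with updateAt-const (relabel ∘ f) c w gw
  ...   | inj₁ (refl , _) = inj₂ (inj₂ refl)
  ...   | inj₂ (_ , rw)   = ⊥-elim (relabel≢path (f w) rw)
    where
    relabel≢path : ∀ r → relabel r ≢ pathLabel
    relabel≢path (cliqueLabel _) ()
    relabel≢path pathLabel       ()

S1-step-one : S1Partition (suc l) 0 H → S1Partition (suc (suc l)) 1 (step H (suc l))
S1-step-one {l} {H} (f , _ , cliques , iso) =
  label , stables′ , cliques′ ,
  path-iso (path-x-old-x {zero} {suc zero} (λ ()) b) (label-x zero)
           (trans (label-old b) (updateAt-updates b _)) (label-x (suc zero)) on-path
  where
  open Step H (suc l)
  b = InducedEmbedding.φ (proj₁ iso) (suc zero)

  relabel : Fin 0 ⊎ (Fin l ⊎ ⊤) → Fin 1 ⊎ (Fin l ⊎ ⊤)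
  relabel (cliqueLabel j) = cliqueLabel j
  relabel pathLabel       = stableLabel zero

  g : Fin (n H) → Fin 1 ⊎ (Fin l ⊎ ⊤)
  g = updateAt (relabel ∘ f) b (const pathLabel)

  x-label : Fin (suc (suc l)) → Fin 1 ⊎ (Fin l ⊎ ⊤)
  x-label zero          = pathLabel
  x-label (suc zero)    = pathLabel
  x-label (suc (suc j)) = cliqueLabel j

  open Labelling g (stableLabel zero) x-label

  ac-stable : Class {H} g (stableLabel zero) ⊆ (λ w → f w ≡ pathLabel × w ≢ b)
  ac-stable {w} gw with updateAt-const (relabel ∘ f) b w gw
  ... | inj₁ (_ , ())
  ... | inj₂ (w≢b , rw) = unrelabel (f w) rw , w≢b
    where
    unrelabel : ∀ r → relabel r ≡ stableLabel zero → r ≡ pathLabel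
    unrelabel pathLabel _ = refl

  old-clique : ∀ {j} → Class {H} g (cliqueLabel j) ⊆ Class {H} f (cliqueLabel j)
  old-clique {j} {w} gw with updateAt-const (relabel ∘ f) b w gw
  ... | inj₁ (_ , ())
  ... | inj₂ (_ , rw) = unrelabel (f w) rw
    where
    unrelabel : ∀ r → relabel r ≡ cliqueLabel j → r ≡ cliqueLabel j
    unrelabel (cliqueLabel _) refl = refl

  stables′ : ∀ i → Stable (step H (suc l)) (Class {step H (suc l)} label (stableLabel i))
  stables′ zero = label-stable (stable-⊆ {H} ac-stable (P3-iso-stable-off-centre iso)) (inj₁ never-stable)
    where
    never-stable : ∀ y → x-label y ≢ stableLabel zero
    never-stable zero          ()
    never-stable (suc zero)    ()
    never-stable (suc (suc _)) ()

  cliques′ : ∀ j → Clique (step H (suc l)) (Class {step H (suc l)} label (cliqueLabel j))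
  cliques′ j = label-clique (clique-⊆ {H} old-clique (cliques j)) (λ ()) unique
    where
    unique : ∀ {y y′} → x-label y ≡ cliqueLabel j → x-label y′ ≡ cliqueLabel j → y ≡ y′
    unique {suc (suc _)} {suc (suc _)} refl refl = refl

  on-path : ∀ {u} → label u ≡ pathLabel → u ≡ new-x zero ⊎ u ≡ old b ⊎ u ≡ new-x (suc zero)
  on-path {u} lu with member u lu
  ... | x-member {zero} _     = inj₁ refl
  ... | x-member {suc zero} _ = inj₂ (inj₂ refl)
  ... | old-member {w} gw with updateAt-const (relabel ∘ f) b w gw
  ...   | inj₁ (refl , _) = inj₂ (inj₁ refl)
  ...   | inj₂ (_ , rw)   = ⊥-elim (relabel≢path (f w) rw)
    where
    relabel≢path : ∀ r → relabel r ≢ pathLabel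
    relabel≢path (cliqueLabel _) ()
    relabel≢path pathLabel       ()

jumble : ℕ → Graph
jumble zero    = P3
jumble (suc k) = step (jumble k) (suc k)

P3-S1 : S1Partition 1 0 P3
P3-S1 = const pathLabel , (λ ()) , (λ ()) , path-iso P3-path refl refl refl on-path
  where
  on-path : Class {P3} (const pathLabel) pathLabel ⊆ (λ u → u ≡ zero ⊎ u ≡ suc zero ⊎ u ≡ suc (suc zero))
  on-path {zero}             _ = inj₁ refl
  on-path {suc zero}         _ = inj₂ (inj₁ refl)
  on-path {suc (suc zero)}   _ = inj₂ (inj₂ refl)

jumble-S1 : ∀ k s → s < suc k → S1Partition (suc k) s (jumble k)
jumble-S1 zero    zero          _         = P3-S1
jumble-S1 zero    (suc _)       (s≤s ())
jumble-S1 (suc k) zero          _         = S1-step-zero (jumble-S1 k 0 (s≤s z≤n))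
jumble-S1 (suc k) (suc zero)    _         = S1-step-one (jumble-S1 k 0 (s≤s z≤n))
jumble-S1 (suc k) (suc (suc s)) (s≤s s<k) = S1-step-stable (jumble-S1 k (suc s) s<k)

jumble-unavoidable : ∀ k → P3Unavoidable (suc k) (jumble k)
jumble-unavoidable zero    = P3-unavoidable
jumble-unavoidable (suc k) = Step.step-unavoidable (jumble k) (suc k) (jumble-unavoidable k)

jumble-isJumble : ∀ k → IsJumble (suc k) (jumble k)
jumble-isJumble k = record
  { S1 = jumble-S1 k
  ; S2 = λ f → let i , e = jumble-unavoidable k f in i , λ free → free e
  }

theorem3p5 : ∀ (m : ℕ) → Σ ℕ λ l → m < l × Σ Graph (IsJumble l)
theorem3p5 m = suc m , ≤-refl , jumble m , jumble-isJumble m
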